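{- Let $D$ be a defeasible theory, let $S_D$ and $S^*_D$ be its compiled programs, and let $q(\vec a)$ be a ground literal ($q$ has the form $p$ or $\neg p$ in $D$, written $\mathtt{p}$ or $\mathtt{not\_p}$ in the programs). Then $\mathcal M_{\partial_{||}}(D)\models_{WF}\mathtt{definitely}(q(\vec a))$ iff $S_D\models_{WF}\mathtt{definitely\_q}(\vec a)$; $\mathcal M_{\partial_{||}}(D)\models_{WF}\mathtt{lambda}(q(\vec a))$ iff $S_D\models_{WF}\mathtt{lambda\_q}(\vec a)$; $\mathcal M_{\partial_{||}}(D)\models_{WF}\mathtt{defeasibly}(q(\vec a))$ iff $S_D\models_{WF}\mathtt{defeasibly\_q}(\vec a)$; and the same three equivalences hold with $\mathcal M_{\partial^*_{||}}(D)$ in place of $\mathcal M_{\partial_{||}}(D)$ and $S^*_D$ in place of $S_D$.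
   Context: Defeasible theories. A literal is an atom $p(t_1,\dots,t_n)$ or its classical negation $\neg p(t_1,\dots,t_n)$; ${\sim}q$ is the complementary literal. A defeasible theory $D=(F,R,>)$ consists of a finite set $F$ of variable-free literals (facts), a finite set $R$ of labelled rules $r$ with antecedent set $A(r)$, consequent $C(r)$ and kind strict ($\to$), defeasible ($\Rightarrow$) or defeater ($\leadsto$), and an acyclic superiority relation $>$ on labels. Metaprograms. $D$ is represented by unit clauses $\mathtt{fact}(q)$ ($q\in F$), $\mathtt{strict}(r,q,[q_1,\dots,q_n])$, $\mathtt{defeasible}(r,q,[q_1,\dots,q_n])$, $\mathtt{defeater}(r,q,[q_1,\dots,q_n])$ (rules $r:q_1,\dots,q_n\hookrightarrow q$ of the respective kind), $\mathtt{sup}(r,s)$ ($r>s$); predicates of $D$ become function symbols and $\neg p(\vec t)$ is written $\mathtt{not\_p}(\vec t)$; for each predicate $p$, also $\mathtt{neg}(\mathtt{p}(\vec X),\mathtt{not\_p}(\vec X))$ and $\mathtt{neg}(\mathtt{not\_p}(\vec X),\mathtt{p}(\vec X))$. $\mathcal M_{\partial_{||}}(D)$ is this with: $\mathtt{rule}(R,H,B)\,\text{:- }\,\mathtt{strict\_or\_defeasible}(R,H,B)$; $\mathtt{rule}(R,H,B)\,\text{:- }\,\mathtt{defeater}(R,H,B)$; $\mathtt{strict\_or\_defeasible}(R,H,B)\,\text{:- }\,\mathtt{strict}(R,H,B)$; $\mathtt{strict\_or\_defeasible}(R,H,B)\,\text{:- }\,\mathtt{defeasible}(R,H,B)$; for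 $\tau\in\{\mathtt{definitely},\mathtt{lambda},\mathtt{defeasibly}\}$: $\mathtt{loop\_}\tau([\,])$, $\mathtt{loop\_}\tau([H|T])\,\text{:- }\,\tau(H),\mathtt{loop\_}\tau(T)$; $\mathtt{definitely}(X)\,\text{:- }\,\mathtt{fact}(X)$; $\mathtt{definitely}(X)\,\text{:- }\,\mathtt{strict}(R,X,Y),\mathtt{loop\_definitely}(Y)$; $\mathtt{lambda}(X)\,\text{:- }\,\mathtt{definitely}(X)$; $\mathtt{lambda}(X)\,\text{:- }\,\mathtt{neg}(X,X'),\ not\ \mathtt{definitely}(X'),\ \mathtt{strict\_or\_defeasible}(R,X,Y),\ \mathtt{loop\_lambda}(Y)$; $\mathtt{defeasibly}(X)\,\text{:- }\,\mathtt{definitely}(X)$; $\mathtt{defeasibly}(X)\,\text{:- }\,\mathtt{neg}(X,X'),\ not\ \mathtt{definitely}(X'),\ \mathtt{strict\_or\_defeasible}(R,X,Y),\ \mathtt{loop\_defeasibly}(Y),\ not\ \mathtt{overruled}(X)$; $\mathtt{overruled}(X)\,\text{:- }\,\mathtt{neg}(X,X'),\ \mathtt{rule}(S,X',U),\ \mathtt{loop\_lambda}(U),\ not\ \mathtt{defeated}(S,X')$; $\mathtt{defeated}(S,X')\,\text{:- }\,\mathtt{neg}(X,X'),\ \mathtt{sup}(T,S),\ \mathtt{strict\_or\_defeasible}(T,X,V),\ \mathtt{loop\_defeasibly}(V)$. $\mathcal M_{\partial^*_{||}}(D)$ is identical except its last three clauses are replaced by: $\mathtt{defeasibly}(X)\,\text{:-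 }\,\mathtt{neg}(X,X'),\ not\ \mathtt{definitely}(X'),\ \mathtt{strict\_or\_defeasible}(R,X,Y),\ \mathtt{loop\_defeasibly}(Y),\ not\ \mathtt{overruled}(R,X)$; $\mathtt{overruled}(R,X)\,\text{:- }\,\mathtt{neg}(X,X'),\ \mathtt{rule}(S,X',U),\ \mathtt{loop\_lambda}(U),\ not\ \mathtt{defeats}(R,S)$; $\mathtt{defeats}(R,S)\,\text{:- }\,\mathtt{sup}(R,S)$. Compiled programs. For a literal $q$ with predicate $p$, $\mathtt{q}$ denotes $\mathtt{p}$ if $q$ is positive and $\mathtt{not\_p}$ if negative; $\mathtt{{\sim}q}$ is the name of the complement; predicate names are formed by concatenation; rule labels are constants. $S_D$ consists exactly of: (i) for each fact $q(\vec a)$: unit clauses $\mathtt{definitely\_q}(\vec a)$, $\mathtt{lambda\_q}(\vec a)$, $\mathtt{defeasibly\_q}(\vec a)$; (ii) for each strict rule $r:q_1(\vec a_1),\dots,q_n(\vec a_n)\to q(\vec a)$: $\mathtt{definitely\_q}(\vec a)\,\text{:- }\,\mathtt{body}^\Delta_r(\vec a)$, $\mathtt{lambda\_q}(\vec a)\,\text{:- }\,\mathtt{body}^\Delta_r(\vec a)$, $\mathtt{defeasibly\_q}(\vec a)\,\text{:- }\,\mathtt{body}^\Delta_r(\vec a)$, $\mathtt{body}^\Delta_r(\vec a)\,\text{:- }\,\mathtt{definitely\_q_1}(\vec a_1),\dots,\mathtt{definitely\_q_n}(\vec a_n)$; (iii) for each strict or defeasible rule $r:q_1(\vec a_1),\dots,q_n(\vec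 a_n)\hookrightarrow q(\vec a)$: $\mathtt{lambda\_q}(\vec a)\,\text{:- }\,not\ \mathtt{definitely\_{\sim}q}(\vec a),\mathtt{body}^\lambda_r(\vec a)$ and $\mathtt{defeasibly\_q}(\vec a)\,\text{:- }\,not\ \mathtt{definitely\_{\sim}q}(\vec a),\mathtt{body}^d_r(\vec a),not\ \mathtt{overruled\_q}(\vec a)$; (iv) for each rule $s$ of any kind, $s:q_1(\vec a_1),\dots,q_n(\vec a_n)\hookrightarrow q(\vec a)$: $\mathtt{body}^\lambda_s(\vec a)\,\text{:- }\,\mathtt{lambda\_q_1}(\vec a_1),\dots,\mathtt{lambda\_q_n}(\vec a_n)$, $\mathtt{body}^d_s(\vec a)\,\text{:- }\,\mathtt{defeasibly\_q_1}(\vec a_1),\dots,\mathtt{defeasibly\_q_n}(\vec a_n)$, $\mathtt{overruled\_{\sim}q}(\vec a)\,\text{:- }\,\mathtt{body}^\lambda_s(\vec a),not\ \mathtt{defeated\_q}(s,\vec a)$; (v) for each strict or defeasible rule $t$ with consequent $q(\vec a)$ and each rule $s$ with consequent of the form ${\sim}q(\dots)$ with $t>s$: $\mathtt{defeated\_{\sim}q}(s,\vec a)\,\text{:- }\,\mathtt{body}^d_t(\vec a)$. $S^*_D$ is the same as $S_D$ except that the $\mathtt{defeasibly\_q}$ clauses of (iii), the $\mathtt{overruled}$ clauses of (iv) and the clauses of (v) are replaced by: for each strict or defeasible rule $r$ with consequent $q(\vec a)$, $\mathtt{defeasibly\_q}(\vec a)\,\text{:- }\,not\ \mathtt{definitely\_{\sim}q}(\vec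 a),\mathtt{body}^d_r(\vec a),not\ \mathtt{overruled\_q}(r,\vec a)$; for each such $r$ and each rule $s$ with consequent ${\sim}q(\vec b)$, $\mathtt{overruled\_q}(r,\vec b)\,\text{:- }\,\mathtt{body}^\lambda_s(\vec b),not\ \mathtt{defeats\_q}(r,s)$; for each $r>s$ with $r$ having consequent literal $q$, the unit clause $\mathtt{defeats\_q}(r,s)$. $P\models_{WF}\ell$ means the ground literal $\ell$ holds in the well-founded model of the logic program $P$. -}

module Defs where

open import Data.Nat using (ℕ)
open import Data.Bool using (Bool; true; false; not)
open import Data.List using (List; []; _∷_; map; length; upTo; _++_; concatMap)
open import Data.List.Membership.Propositional using (_∈_)
open import Data.List.Relation.Unary.All using (All)
open import Data.List.Relation.Unary.Unique.Propositional using (Unique)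
open import Data.Product using (_×_; _,_)
open import Data.Sum using (_⊎_)
open import Relation.Nullary using (¬_)
open import Relation.Binary.PropositionalEquality using (_≡_; _≢_)
open import Level using () renaming (suc to lsuc; zero to lzero)

data Term (F : Set) : Set where
  var : ℕ → Term F
  fn  : F → List (Term F) → Term F

data GTerm (F : Set) : Set where
  gfn : F → List (GTerm F) → GTerm F

data GroundTerm {F : Set} : Term F → Set where
  fnG : ∀ {f ts} → All GroundTerm ts → GroundTerm (fn f ts)

module _ {F G : Set} (h : F → G) where
  mutual
    tmap : Term F → Term G
    tmap (var x)   = var x
    tmap (fn f ts) = fn (h f) (tmaps ts)

    tmaps : List (Term F) → List (Term G)
    tmaps []       = []
    tmaps (t ∷ ts) = tmap t ∷ tmaps ts

  mutual
    gmap : GTerm F → GTerm G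
    gmap (gfn f ts) = gfn (h f) (gmaps ts)

    gmaps : List (GTerm F) → List (GTerm G)
    gmaps []       = []
    gmaps (t ∷ ts) = gmap t ∷ gmaps ts

module _ {F : Set} (σ : ℕ → GTerm F) where
  mutual
    substT : Term F → GTerm F
    substT (var x)   = σ x
    substT (fn f ts) = gfn f (substTs ts)

    substTs : List (Term F) → List (GTerm F)
    substTs []       = []
    substTs (t ∷ ts) = substT t ∷ substTs ts

-- Normal logic programs (possibly infinite sets of clauses) and the
-- well-founded semantics (alternating fixpoint characterisation)

infix 8 _⦅_⦆
infix 8 _⟦_⟧
infix 2 _:-_∣_

record Atom (P F : Set) : Set where
  constructor _⦅_⦆
  field
    pred : P
    args : List (Term F)

record GAtom (P F : Set) : Set where
  constructor _⟦_⟧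
  field
    pred : P
    args : List (GTerm F)

record Clause (P F : Set) : Set where
  constructor _:-_∣_
  field
    head : Atom P F
    pos  : List (Atom P F)
    neg  : List (Atom P F)

Program : Set → Set → Set₁
Program P F = Clause P F → Set

_∪ᴾ_ : ∀ {P F} → Program P F → Program P F → Program P F
(Π₁ ∪ᴾ Π₂) c = Π₁ c ⊎ Π₂ c

substA : ∀ {P F} → (ℕ → GTerm F) → Atom P F → GAtom P F
substA σ (p ⦅ ts ⦆) = p ⟦ substTs σ ts ⟧

-- Γ_Π(I): least Herbrand model of the Gelfond–Lifschitz reduct Π^I
-- (ground instances are over the Herbrand universe GTerm F)
data Γ {P F : Set} (Π : Program P F) (I : GAtom P F → Set) : GAtom P F → Set where
  derive : (c : Clause P F) → Π c → (σ : ℕ → GTerm F) →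
           All (λ b → Γ Π I (substA σ b)) (Clause.pos c) →
           All (λ b → ¬ I (substA σ b)) (Clause.neg c) →
           Γ Π I (substA σ (Clause.head c))

-- P ⊨WF ℓ : the ground atom ℓ is true in the well-founded model of P,
-- i.e. ℓ belongs to the least fixpoint of the monotone operator Γ_P ∘ Γ_P
-- (Van Gelder's alternating fixpoint), the least fixpoint being the
-- intersection of all prefixed points.
_⊨WF_ : ∀ {P F} → Program P F → GAtom P F → Set₁
_⊨WF_ {P} {F} Π ℓ =
  (X : GAtom P F → Set) → (∀ a → Γ Π (Γ Π X) a → X a) → X ℓ

record Lit : Set where
  constructor lit
  field
    positive : Bool
    pred     : ℕ
    args     : List (Term ℕ)

∼_ : Lit → Lit
∼ lit b p ts = lit (not b) p ts

data Kind : Set where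
  strictK defeasibleK defeaterK : Kind

data SD : Kind → Set where
  sdStrict     : SD strictK
  sdDefeasible : SD defeasibleK

record Rule : Set where
  constructor mkRule
  field
    label : ℕ
    kind  : Kind
    ante  : List Lit
    cons  : Lit

record Theory : Set where
  field
    facts : List Lit
    rules : List Rule
    supRel : List (ℕ × ℕ)     -- (r , s) ∈ sup  means  r > s

open Theory public

data _>⁺_ (D : Theory) : ℕ → ℕ → Set where
  one  : ∀ {r s} → (r , s) ∈ supRel D → _>⁺_ D r s
  more : ∀ {r s t} → (r , s) ∈ supRel D → _>⁺_ D s t → _>⁺_ D r t

record WellFormed (D : Theory) : Set where
  field
    factsGround : All (λ q → All GroundTerm (Lit.args q)) (facts D)
    labelsUnique : Unique (map Rule.label (rules D))
    acyclic : ∀ r → ¬ (_>⁺_ D r r)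

litsOf : Theory → List Lit
litsOf D = facts D ++ concatMap (λ r → Rule.cons r ∷ Rule.ante r) (rules D)

signature : Theory → List (ℕ × ℕ)
signature D = map (λ q → Lit.pred q , length (Lit.args q)) (litsOf D)

data MFun : Set where
  dfun   : ℕ → MFun
  mpred  : Bool → ℕ → MFun   -- p (true) and not_p (false) as function symbols
  mnil   : MFun
  mcons  : MFun
  mlabel : ℕ → MFun

data Tag : Set where
  definitelyT lambdaT defeasiblyT : Tag

data MPred : Set where
  fact strict defeasible defeater sup neg rule strictOrDefeasible : MPred
  τ    : Tag → MPred
  loop : Tag → MPred
  overruled defeated defeats : MPred

MTerm = Term MFun
MClause = Clause MPred MFun

mlist : List MTerm → MTerm
mlist []       = fn mnil []
mlist (t ∷ ts) = fn mcons (t ∷ mlist ts ∷ [])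

mlit : Lit → MTerm
mlit (lit b p ts) = fn (mpred b p) (tmaps dfun ts)

mlab : ℕ → MTerm
mlab r = fn (mlabel r) []

kindPred : Kind → MPred
kindPred strictK     = strict
kindPred defeasibleK = defeasible
kindPred defeaterK   = defeater

vX vY vR vS vU vT vV vX' vH vB : MTerm
vX = var 0 ; vY = var 1 ; vR = var 2 ; vS = var 3 ; vU = var 4
vT = var 5 ; vV = var 6 ; vX' = var 7 ; vH = var 8 ; vB = var 9

data MBase (D : Theory) : Program MPred MFun where
  mFact : ∀ {q} → q ∈ facts D → MBase D (fact ⦅ mlit q ∷ [] ⦆ :- [] ∣ [])
  mRule : ∀ {r} → r ∈ rules D →
    MBase D (kindPred (Rule.kind r) ⦅ mlab (Rule.label r) ∷ mlit (Rule.cons r)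
               ∷ mlist (map mlit (Rule.ante r)) ∷ [] ⦆ :- [] ∣ [])
  mSup : ∀ {r s} → (r , s) ∈ supRel D → MBase D (sup ⦅ mlab r ∷ mlab s ∷ [] ⦆ :- [] ∣ [])
  mNeg : ∀ {p n} (b : Bool) → (p , n) ∈ signature D →
    MBase D (neg ⦅ fn (mpred b p) (map var (upTo n))
                 ∷ fn (mpred (not b) p) (map var (upTo n)) ∷ [] ⦆ :- [] ∣ [])
  mRule1 : MBase D (rule ⦅ vR ∷ vH ∷ vB ∷ [] ⦆ :- strictOrDefeasible ⦅ vR ∷ vH ∷ vB ∷ [] ⦆ ∷ [] ∣ [])
  mRule2 : MBase D (rule ⦅ vR ∷ vH ∷ vB ∷ [] ⦆ :- defeater ⦅ vR ∷ vH ∷ vB ∷ [] ⦆ ∷ [] ∣ [])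
  mSD1 : MBase D (strictOrDefeasible ⦅ vR ∷ vH ∷ vB ∷ [] ⦆ :- strict ⦅ vR ∷ vH ∷ vB ∷ [] ⦆ ∷ [] ∣ [])
  mSD2 : MBase D (strictOrDefeasible ⦅ vR ∷ vH ∷ vB ∷ [] ⦆ :- defeasible ⦅ vR ∷ vH ∷ vB ∷ [] ⦆ ∷ [] ∣ [])
  mLoopNil  : (t : Tag) → MBase D (loop t ⦅ mlist [] ∷ [] ⦆ :- [] ∣ [])
  mLoopCons : (t : Tag) → MBase D (loop t ⦅ fn mcons (vH ∷ vT ∷ []) ∷ [] ⦆
                                     :- τ t ⦅ vH ∷ [] ⦆ ∷ loop t ⦅ vT ∷ [] ⦆ ∷ [] ∣ [])
  mDef1 : MBase D (τ definitelyT ⦅ vX ∷ [] ⦆ :- fact ⦅ vX ∷ [] ⦆ ∷ [] ∣ [])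
  mDef2 : MBase D (τ definitelyT ⦅ vX ∷ [] ⦆
                   :- strict ⦅ vR ∷ vX ∷ vY ∷ [] ⦆ ∷ loop definitelyT ⦅ vY ∷ [] ⦆ ∷ [] ∣ [])
  mLam1 : MBase D (τ lambdaT ⦅ vX ∷ [] ⦆ :- τ definitelyT ⦅ vX ∷ [] ⦆ ∷ [] ∣ [])
  mLam2 : MBase D (τ lambdaT ⦅ vX ∷ [] ⦆
                   :- neg ⦅ vX ∷ vX' ∷ [] ⦆ ∷ strictOrDefeasible ⦅ vR ∷ vX ∷ vY ∷ [] ⦆
                      ∷ loop lambdaT ⦅ vY ∷ [] ⦆ ∷ []
                   ∣ τ definitelyT ⦅ vX' ∷ [] ⦆ ∷ [])
  mDfs1 : MBase D (τ defeasiblyT ⦅ vX ∷ [] ⦆ :- τ definitelyT ⦅ vX ∷ [] ⦆ ∷ [] ∣ [])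

data MPar (D : Theory) : Program MPred MFun where
  mDfs2 : MPar D (τ defeasiblyT ⦅ vX ∷ [] ⦆
                  :- neg ⦅ vX ∷ vX' ∷ [] ⦆ ∷ strictOrDefeasible ⦅ vR ∷ vX ∷ vY ∷ [] ⦆
                     ∷ loop defeasiblyT ⦅ vY ∷ [] ⦆ ∷ []
                  ∣ τ definitelyT ⦅ vX' ∷ [] ⦆ ∷ overruled ⦅ vX ∷ [] ⦆ ∷ [])
  mOver : MPar D (overruled ⦅ vX ∷ [] ⦆
                  :- neg ⦅ vX ∷ vX' ∷ [] ⦆ ∷ rule ⦅ vS ∷ vX' ∷ vU ∷ [] ⦆
                     ∷ loop lambdaT ⦅ vU ∷ [] ⦆ ∷ []
                  ∣ defeated ⦅ vS ∷ vX' ∷ [] ⦆ ∷ [])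
  mDefd : MPar D (defeated ⦅ vS ∷ vX' ∷ [] ⦆
                  :- neg ⦅ vX ∷ vX' ∷ [] ⦆ ∷ sup ⦅ vT ∷ vS ∷ [] ⦆
                     ∷ strictOrDefeasible ⦅ vT ∷ vX ∷ vV ∷ [] ⦆
                     ∷ loop defeasiblyT ⦅ vV ∷ [] ⦆ ∷ [] ∣ [])

data MStar (D : Theory) : Program MPred MFun where
  mDfs2* : MStar D (τ defeasiblyT ⦅ vX ∷ [] ⦆
                    :- neg ⦅ vX ∷ vX' ∷ [] ⦆ ∷ strictOrDefeasible ⦅ vR ∷ vX ∷ vY ∷ [] ⦆
                       ∷ loop defeasiblyT ⦅ vY ∷ [] ⦆ ∷ []
                    ∣ τ definitelyT ⦅ vX' ∷ [] ⦆ ∷ overruled ⦅ vR ∷ vX ∷ [] ⦆ ∷ [])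
  mOver* : MStar D (overruled ⦅ vR ∷ vX ∷ [] ⦆
                    :- neg ⦅ vX ∷ vX' ∷ [] ⦆ ∷ rule ⦅ vS ∷ vX' ∷ vU ∷ [] ⦆
                       ∷ loop lambdaT ⦅ vU ∷ [] ⦆ ∷ []
                    ∣ defeats ⦅ vR ∷ vS ∷ [] ⦆ ∷ [])
  mDefs* : MStar D (defeats ⦅ vR ∷ vS ∷ [] ⦆ :- sup ⦅ vR ∷ vS ∷ [] ⦆ ∷ [] ∣ [])

M∂ : Theory → Program MPred MFun
M∂ D = MBase D ∪ᴾ MPar D

M∂* : Theory → Program MPred MFun
M∂* D = MBase D ∪ᴾ MStar D

data SFun : Set where
  sfun   : ℕ → SFun
  slabel : ℕ → SFun

-- a literal name q is a pair (sign , predicate): p or not_p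
data SPred : Set where
  definitely_ lambda_ defeasibly_ overruled_ defeated_ defeats_ : Bool → ℕ → SPred
  bodyΔ bodyλ bodyd : ℕ → SPred

STerm = Term SFun

sargs : Lit → List STerm
sargs q = tmaps sfun (Lit.args q)

slab : ℕ → STerm
slab r = fn (slabel r) []

infix 9 _at_
_at_ : (Bool → ℕ → SPred) → Lit → Atom SPred SFun
X at q = X (Lit.positive q) (Lit.pred q) ⦅ sargs q ⦆

sameName : Lit → Lit → Set
sameName q q' = (Lit.positive q ≡ Lit.positive q') × (Lit.pred q ≡ Lit.pred q')

bodyAtom : (ℕ → SPred) → Rule → Atom SPred SFun
bodyAtom B r = B (Rule.label r) ⦅ sargs (Rule.cons r) ⦆

data SBase (D : Theory) : Program SPred SFun where
  sFact : ∀ {q} → q ∈ facts D → (X : Bool → ℕ → SPred) →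
          X ≡ definitely_ ⊎ (X ≡ lambda_ ⊎ X ≡ defeasibly_) →
          SBase D ((X at q) :- [] ∣ [])
  sStrict : ∀ {r} → r ∈ rules D → Rule.kind r ≡ strictK →
          (X : Bool → ℕ → SPred) →
          X ≡ definitely_ ⊎ (X ≡ lambda_ ⊎ X ≡ defeasibly_) →
          SBase D ((X at Rule.cons r) :- bodyAtom bodyΔ r ∷ [] ∣ [])
  sBodyΔ : ∀ {r} → r ∈ rules D → Rule.kind r ≡ strictK →
          SBase D (bodyAtom bodyΔ r :- map (definitely_ at_) (Rule.ante r) ∣ [])
  sLam : ∀ {r} → r ∈ rules D → SD (Rule.kind r) →
          SBase D ((lambda_ at Rule.cons r) :- bodyAtom bodyλ r ∷ []
                    ∣ (definitely_ at (∼ Rule.cons r)) ∷ [])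
  sBodyλ : ∀ {s} → s ∈ rules D →
          SBase D (bodyAtom bodyλ s :- map (lambda_ at_) (Rule.ante s) ∣ [])
  sBodyd : ∀ {s} → s ∈ rules D →
          SBase D (bodyAtom bodyd s :- map (defeasibly_ at_) (Rule.ante s) ∣ [])

data SPar (D : Theory) : Program SPred SFun where
  sDfs : ∀ {r} → r ∈ rules D → SD (Rule.kind r) →
          SPar D ((defeasibly_ at Rule.cons r) :- bodyAtom bodyd r ∷ []
                   ∣ (definitely_ at (∼ Rule.cons r)) ∷ (overruled_ at Rule.cons r) ∷ [])
  sOver : ∀ {s} → s ∈ rules D →
          SPar D ((overruled_ at (∼ Rule.cons s)) :- bodyAtom bodyλ s ∷ []
                   ∣ (defeated_ (Lit.positive (Rule.cons s)) (Lit.pred (Rule.cons s))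
                        ⦅ slab (Rule.label s) ∷ sargs (Rule.cons s) ⦆) ∷ [])
  sDefd : ∀ {t s} → t ∈ rules D → SD (Rule.kind t) → s ∈ rules D →
          sameName (Rule.cons s) (∼ Rule.cons t) →
          (Rule.label t , Rule.label s) ∈ supRel D →
          SPar D (defeated_ (not (Lit.positive (Rule.cons t))) (Lit.pred (Rule.cons t))
                    ⦅ slab (Rule.label s) ∷ sargs (Rule.cons t) ⦆
                  :- bodyAtom bodyd t ∷ [] ∣ [])

data SStar (D : Theory) : Program SPred SFun where
  sDfs* : ∀ {r} → r ∈ rules D → SD (Rule.kind r) →
          SStar D ((defeasibly_ at Rule.cons r) :- bodyAtom bodyd r ∷ []
                    ∣ (definitely_ at (∼ Rule.cons r))
                      ∷ (overruled_ (Lit.positive (Rule.cons r)) (Lit.pred (Rule.cons r))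
                           ⦅ slab (Rule.label r) ∷ sargs (Rule.cons r) ⦆) ∷ [])
  sOver* : ∀ {r s} → r ∈ rules D → SD (Rule.kind r) → s ∈ rules D →
          sameName (Rule.cons s) (∼ Rule.cons r) →
          SStar D (overruled_ (Lit.positive (Rule.cons r)) (Lit.pred (Rule.cons r))
                     ⦅ slab (Rule.label r) ∷ sargs (Rule.cons s) ⦆
                   :- bodyAtom bodyλ s ∷ []
                   ∣ (defeats_ (Lit.positive (Rule.cons r)) (Lit.pred (Rule.cons r))
                        ⦅ slab (Rule.label r) ∷ slab (Rule.label s) ∷ [] ⦆) ∷ [])
  sDefs* : ∀ {r s} → r ∈ rules D → (Rule.label r , s) ∈ supRel D →
          SStar D (defeats_ (Lit.positive (Rule.cons r)) (Lit.pred (Rule.cons r))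
                     ⦅ slab (Rule.label r) ∷ slab s ∷ [] ⦆ :- [] ∣ [])

S : Theory → Program SPred SFun
S D = SBase D ∪ᴾ SPar D

S* : Theory → Program SPred SFun
S* D = SBase D ∪ᴾ SStar D

mQuery : Tag → Bool → ℕ → List (GTerm ℕ) → GAtom MPred MFun
mQuery t b p as = τ t ⟦ gfn (mpred b p) (gmaps dfun as) ∷ [] ⟧

sQuery : (Bool → ℕ → SPred) → Bool → ℕ → List (GTerm ℕ) → GAtom SPred SFun
sQuery X b p as = X b p ⟦ gmaps sfun as ⟧

module Submission where

-- Each atom of a compiled program is the specialisation of an atom of the corresponding
-- metaprogram to a fixed literal or rule: X_q(a⃗) is X(q(a⃗)) for X ∈ {definitely, lambda,
-- defeasibly}, overruled_q(a⃗) is overruled(q(a⃗)), defeated_q(s,a⃗) is defeated(s,q(a⃗)),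
-- and in the ∂* variant overruled_q(r,a⃗) is overruled(r,q(a⃗)) and defeats_q(r,s) is
-- defeats(r,s); the atoms body_r stand for loop atoms over the antecedent of r. Under this
-- correspondence one step of the Gelfond–Lifschitz operator Γ of either program is
-- simulated by one step of the other, provided the interpretations consulted by negative
-- premises are related in the opposite direction (Γ is antitone). Hence Γ∘Γ preserves the
-- correspondence both ways, and so do its least fixpoints, the well-founded models.
-- Each simulation is an induction on derivations, with an invariant stating what every
-- derivable atom of one program means in the other. Ground instances are carried across
-- by a bijection between the two Herbrand universes, and since rule labels are distinct
-- an atom body_r determines its rule.


open import Defs
open Rule using (label; kind; ante; cons)
open import Data.Nat using (ℕ; zero; suc; _≡ᵇ_)
open import Data.Bool using (Bool; true; false; not; if_then_else_)
open import Data.Bool.Properties using (not-involutive)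
open import Data.List using (List; []; _∷_; map; length; upTo; applyUpTo; concatMap)
open import Data.List.Membership.Propositional using (_∈_)
open import Data.List.Membership.Propositional.Properties using (∈-map⁺; ∈-++⁺ʳ)
open import Data.List.Relation.Unary.All as All using (All; []; _∷_)
open import Data.List.Relation.Unary.All.Properties using (map⁺; map⁻)
open import Data.List.Relation.Unary.Any using (here; there)
open import Data.List.Relation.Unary.Unique.Propositional using (Unique)
open import Data.List.Relation.Unary.AllPairs using ([]; _∷_)
open import Data.Product using (Σ; _×_; _,_; map₂; uncurry)
open import Data.Sum using (_⊎_; inj₁; inj₂)
open import Data.Empty using (⊥-elim)
open import Data.Unit using (⊤; tt)
open import Function.Base using (id; _∘_; flip)
open import Function.Bundles using (_⇔_; mk⇔)
open import Relation.Nullary using (¬_)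
open import Relation.Binary.PropositionalEquality using (_≡_; refl; sym; trans; cong; cong₂; subst; subst₂)

module _ {P F : Set} where

  Preserves : Program P F → (GAtom P F → Set) → (GAtom P F → Set) → Set
  Preserves Π I G = ∀ {c} → Π c → (σ : ℕ → GTerm F) →
    All (λ b → G (substA σ b)) (Clause.pos c) →
    All (λ b → ¬ I (substA σ b)) (Clause.neg c) → G (substA σ (Clause.head c))

  Preserves-∪ : ∀ {Π₁ Π₂ I G} → Preserves Π₁ I G → Preserves Π₂ I G → Preserves (Π₁ ∪ᴾ Π₂) I G
  Preserves-∪ pres₁ pres₂ (inj₁ c) = pres₁ c
  Preserves-∪ pres₁ pres₂ (inj₂ c) = pres₂ c

  Γ-induction : ∀ {Π I G} → Preserves Π I G → ∀ {a} → Γ Π I a → G a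
  Γ-induction {Π} {I} {G} pres (derive c c∈ σ ps ns) = pres c∈ σ (all ps) ns
    where
    all : ∀ {bs} → All (λ b → Γ Π I (substA σ b)) bs → All (λ b → G (substA σ b)) bs
    all []       = []
    all (d ∷ ds) = Γ-induction {G = G} pres d ∷ all ds

Simulation : ∀ {P₁ F₁ P₂ F₂} → Program P₁ F₁ → Program P₂ F₂ →
  (GAtom P₁ F₁ → GAtom P₂ F₂ → Set) → Set₁
Simulation Π₁ Π₂ R = ∀ {I₁ I₂} → (∀ {a b} → R a b → I₂ b → I₁ a) →
  ∀ {a b} → R a b → Γ Π₁ I₁ a → Γ Π₂ I₂ b

⊨WF-preserved : ∀ {P₁ F₁ P₂ F₂} {Π₁ : Program P₁ F₁} {Π₂ : Program P₂ F₂} {R} →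
  Simulation Π₁ Π₂ R → Simulation Π₂ Π₁ (flip R) →
  ∀ {a b} → R a b → Π₁ ⊨WF a → Π₂ ⊨WF b
⊨WF-preserved {Π₁ = Π₁} {R = R} sim₁₂ sim₂₁ r a⊨ X prefixed = a⊨ X₁ prefixed₁ r
  where
  -- the pullback of a prefixed point of Γ_Π₂ ∘ Γ_Π₂ along R is a prefixed point of Γ_Π₁ ∘ Γ_Π₁
  X₁ : _ → Set
  X₁ a = ∀ {b} → R a b → X b
  prefixed₁ : ∀ a → Γ Π₁ (Γ Π₁ X₁) a → X₁ a
  prefixed₁ a d r = prefixed _ (sim₁₂ (sim₂₁ (λ r x → x r)) r d)

⊨WF-transfer : ∀ {P₁ F₁ P₂ F₂} {Π₁ : Program P₁ F₁} {Π₂ : Program P₂ F₂} {R} →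
  Simulation Π₁ Π₂ R → Simulation Π₂ Π₁ (flip R) →
  ∀ {a b} → R a b → (Π₁ ⊨WF a) ⇔ (Π₂ ⊨WF b)
⊨WF-transfer sim₁₂ sim₂₁ r = mk⇔ (⊨WF-preserved sim₁₂ sim₂₁ r) (⊨WF-preserved sim₂₁ sim₁₂ r)

split : ℕ → Bool × ℕ
split zero          = false , zero
split (suc zero)    = true , zero
split (suc (suc n)) = map₂ suc (split n)

merge : Bool × ℕ → ℕ
merge (b , zero)  = if b then 1 else 0
merge (b , suc k) = suc (suc (merge (b , k)))

split-merge : ∀ x → split (merge x) ≡ x
split-merge (false , zero) = refl
split-merge (true , zero)  = refl
split-merge (b , suc k)    = cong (map₂ suc) (split-merge (b , k))

merge-split : ∀ n → merge (split n) ≡ n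
merge-split zero          = refl
merge-split (suc zero)    = refl
merge-split (suc (suc n)) = cong (λ m → suc (suc m)) (merge-split n)

φ : MFun → SFun
φ (dfun n)    = sfun n
φ mnil        = slabel 0
φ mcons       = slabel 1
φ (mlabel k)  = slabel (suc (suc (merge (false , k))))
φ (mpred b k) = slabel (suc (suc (merge (true , merge (b , k)))))

decode : Bool × ℕ → MFun
decode (false , k) = mlabel k
decode (true , m)  = uncurry mpred (split m)

ψ : SFun → MFun
ψ (sfun n)               = dfun n
ψ (slabel zero)          = mnil
ψ (slabel (suc zero))    = mcons
ψ (slabel (suc (suc n))) = decode (split n)

ψ∘φ : ∀ f → ψ (φ f) ≡ f
ψ∘φ (dfun n)    = refl
ψ∘φ mnil        = refl
ψ∘φ mcons       = refl
ψ∘φ (mlabel k)  = cong decode (split-merge (false , k))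
ψ∘φ (mpred b k) = trans (cong decode (split-merge (true , merge (b , k))))
                        (cong (uncurry mpred) (split-merge (b , k)))

φ∘decode : ∀ x → φ (decode x) ≡ slabel (suc (suc (merge x)))
φ∘decode (false , k) = refl
φ∘decode (true , m)  = cong (λ n → slabel (suc (suc (merge (true , n))))) (merge-split m)

φ∘ψ : ∀ f → φ (ψ f) ≡ f
φ∘ψ (sfun n)               = refl
φ∘ψ (slabel zero)          = refl
φ∘ψ (slabel (suc zero))    = refl
φ∘ψ (slabel (suc (suc n))) = trans (φ∘decode (split n)) (cong (λ m → slabel (suc (suc m))) (merge-split n))

MGTerm SGTerm : Set
MGTerm = GTerm MFun
SGTerm = GTerm SFun

MGAtom SGAtom : Set
MGAtom = GAtom MPred MFun
SGAtom = GAtom SPred SFun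

module _ {F G : Set} {f : F → G} {g : G → F} (g∘f : ∀ x → g (f x) ≡ x) where
  mutual
    gmap-inverse : ∀ t → gmap g (gmap f t) ≡ t
    gmap-inverse (gfn c ts) = cong₂ gfn (g∘f c) (gmaps-inverse ts)

    gmaps-inverse : ∀ ts → gmaps g (gmaps f ts) ≡ ts
    gmaps-inverse []       = refl
    gmaps-inverse (t ∷ ts) = cong₂ _∷_ (gmap-inverse t) (gmaps-inverse ts)

module _ {F G H : Set} {f : F → G} {g : F → H} {h : G → H} (h∘f : ∀ x → h (f x) ≡ g x) where
  mutual
    gmap-∘ : ∀ t → gmap h (gmap f t) ≡ gmap g t
    gmap-∘ (gfn c ts) = cong₂ gfn (h∘f c) (gmaps-∘ ts)

    gmaps-∘ : ∀ ts → gmaps h (gmaps f ts) ≡ gmaps g ts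
    gmaps-∘ []       = refl
    gmaps-∘ (t ∷ ts) = cong₂ _∷_ (gmap-∘ t) (gmaps-∘ ts)

  mutual
    gmap-substT : ∀ σ t → gmap h (substT σ (tmap f t)) ≡ substT (gmap h ∘ σ) (tmap g t)
    gmap-substT σ (var x)   = refl
    gmap-substT σ (fn c ts) = cong₂ gfn (h∘f c) (gmaps-substTs σ ts)

    gmaps-substTs : ∀ σ ts → gmaps h (substTs σ (tmaps f ts)) ≡ substTs (gmap h ∘ σ) (tmaps g ts)
    gmaps-substTs σ []       = refl
    gmaps-substTs σ (t ∷ ts) = cong₂ _∷_ (gmap-substT σ t) (gmaps-substTs σ ts)

toS : MGTerm → SGTerm
toS = gmap φ

toM : SGTerm → MGTerm
toM = gmap ψ

toSs : List MGTerm → List SGTerm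
toSs = gmaps φ

toMs : List SGTerm → List MGTerm
toMs = gmaps ψ

toMs∘toSs : ∀ as → toMs (toSs as) ≡ as
toMs∘toSs = gmaps-inverse ψ∘φ

toSs∘toMs : ∀ as → toSs (toMs as) ≡ as
toSs∘toMs = gmaps-inverse φ∘ψ

toSs-dfun : ∀ as → toSs (gmaps dfun as) ≡ gmaps sfun as
toSs-dfun = gmaps-∘ {f = dfun} {g = sfun} {h = φ} (λ _ → refl)

mlitᵍ : Bool → ℕ → List MGTerm → MGTerm
mlitᵍ b p as = gfn (mpred b p) as

mlabᵍ : ℕ → MGTerm
mlabᵍ r = gfn (mlabel r) []

slabᵍ : ℕ → SGTerm
slabᵍ r = gfn (slabel r) []

argsM : (ℕ → MGTerm) → Lit → List MGTerm
argsM σ q = substTs σ (tmaps dfun (Lit.args q))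

argsS : (ℕ → SGTerm) → Lit → List SGTerm
argsS σ q = substTs σ (sargs q)

litM : (ℕ → MGTerm) → Lit → MGTerm
litM σ q = substT σ (mlit q)

listM : (ℕ → MGTerm) → List Lit → MGTerm
listM σ qs = substT σ (mlist (map mlit qs))

ruleᵍ : MPred → Rule → (ℕ → MGTerm) → MGAtom
ruleᵍ P r σ = P ⟦ mlabᵍ (label r) ∷ litM σ (cons r) ∷ listM σ (ante r) ∷ [] ⟧

argsS-toS : ∀ σ q → argsS (toS ∘ σ) q ≡ toSs (argsM σ q)
argsS-toS σ q = sym (gmaps-substTs {f = dfun} {g = sfun} {h = φ} (λ _ → refl) σ (Lit.args q))

argsM-toM : ∀ σ q → argsM (toM ∘ σ) q ≡ toMs (argsS σ q)
argsM-toM σ q = sym (gmaps-substTs {f = sfun} {g = dfun} {h = ψ} (λ _ → refl) σ (Lit.args q))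

length-argsM : ∀ σ q → length (argsM σ q) ≡ length (Lit.args q)
length-argsM σ q = go (Lit.args q)
  where
  go : ∀ ts → length (substTs σ (tmaps dfun ts)) ≡ length ts
  go []       = refl
  go (t ∷ ts) = cong suc (go ts)

sTag : Tag → Bool → ℕ → SPred
sTag definitelyT = definitely_
sTag lambdaT     = lambda_
sTag defeasiblyT = defeasibly_

infix 6 _↦_
_↦_ : MTerm → MGTerm → MTerm × MGTerm
_↦_ = _,_

-- Variables left unassigned are mapped to an arbitrary term.
⟨_⟩ : List (MTerm × MGTerm) → ℕ → MGTerm
⟨ [] ⟩ _                  = gfn mnil []
⟨ (var i , t) ∷ bs ⟩ j    = if i ≡ᵇ j then t else ⟨ bs ⟩ j
⟨ (fn _ _ , _) ∷ bs ⟩ j   = ⟨ bs ⟩ j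

nth : List MGTerm → ℕ → MGTerm
nth []       _       = gfn mnil []
nth (a ∷ as) zero    = a
nth (a ∷ as) (suc i) = nth as i

substTs-vars : ∀ {F} (σ : ℕ → GTerm F) f n → substTs σ (map var (applyUpTo f n)) ≡ applyUpTo (σ ∘ f) n
substTs-vars σ f zero    = refl
substTs-vars σ f (suc n) = cong (σ (f 0) ∷_) (substTs-vars σ (f ∘ suc) n)

applyUpTo-nth : ∀ as → applyUpTo (nth as) (length as) ≡ as
applyUpTo-nth []       = refl
applyUpTo-nth (a ∷ as) = cong (a ∷_) (applyUpTo-nth as)

substTs-nth-upTo : ∀ as → substTs (nth as) (map var (upTo (length as))) ≡ as
substTs-nth-upTo as = trans (substTs-vars (nth as) id (length as)) (applyUpTo-nth as)

map-injectiveᵘ : ∀ {A B : Set} {f : A → B} {xs : List A} {x y} →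
  Unique (map f xs) → x ∈ xs → y ∈ xs → f x ≡ f y → x ≡ y
map-injectiveᵘ {xs = _ ∷ _} (_ ∷ _) (here refl) (here refl) _ = refl
map-injectiveᵘ {f = f} {xs = _ ∷ _} (fx∉ ∷ _) (here refl) (there y∈) e =
  ⊥-elim (All.lookup fx∉ (∈-map⁺ f y∈) e)
map-injectiveᵘ {f = f} {xs = _ ∷ _} (fy∉ ∷ _) (there x∈) (here refl) e =
  ⊥-elim (All.lookup fy∉ (∈-map⁺ f x∈) (sym e))
map-injectiveᵘ {xs = _ ∷ _} (_ ∷ u) (there x∈) (there y∈) e = map-injectiveᵘ u x∈ y∈ e

cons∈signature : ∀ D {r} → r ∈ rules D →
  (Lit.pred (cons r) , length (Lit.args (cons r))) ∈ signature D
cons∈signature D r∈ = ∈-map⁺ (λ q → Lit.pred q , length (Lit.args q)) (∈-++⁺ʳ (facts D) (cons∈lits r∈))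
  where
  cons∈lits : ∀ {r rs} → r ∈ rs → cons r ∈ concatMap (λ r → cons r ∷ ante r) rs
  cons∈lits (here refl)             = here refl
  cons∈lits {rs = r′ ∷ _} (there p) = ∈-++⁺ʳ (cons r′ ∷ ante r′) (cons∈lits p)

module DeriveM (D : Theory) (Ext : Program MPred MFun) (I : MGAtom → Set) where

  ΓM : MGAtom → Set
  ΓM = Γ (MBase D ∪ᴾ Ext) I

  derive-neg : ∀ b p as → (p , length as) ∈ signature D →
    ΓM (neg ⟦ mlitᵍ b p as ∷ mlitᵍ (not b) p as ∷ [] ⟧)
  derive-neg b p as sig =
    subst (λ bs → ΓM (neg ⟦ mlitᵍ b p bs ∷ mlitᵍ (not b) p bs ∷ [] ⟧)) (substTs-nth-upTo as)
      (derive _ (inj₁ (mNeg b sig)) (nth as) [] [])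

  cons∈signatureᵍ : ∀ {r} → r ∈ rules D → ∀ σ →
    (Lit.pred (cons r) , length (argsM σ (cons r))) ∈ signature D
  cons∈signatureᵍ {r} r∈ σ =
    subst (λ n → (Lit.pred (cons r) , n) ∈ signature D) (sym (length-argsM σ (cons r)))
      (cons∈signature D r∈)

  derive-neg-cons : ∀ {r} → r ∈ rules D → ∀ σ →
    ΓM (neg ⟦ litM σ (cons r) ∷ litM σ (∼ cons r) ∷ [] ⟧)
  derive-neg-cons r∈ σ = derive-neg _ _ _ (cons∈signatureᵍ r∈ σ)

  derive-neg-∼cons : ∀ {r} → r ∈ rules D → ∀ σ →
    ΓM (neg ⟦ litM σ (∼ cons r) ∷ litM σ (cons r) ∷ [] ⟧)
  derive-neg-∼cons {r} r∈ σ =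
    subst (λ b → ΓM (neg ⟦ litM σ (∼ cons r) ∷ mlitᵍ b _ _ ∷ [] ⟧)) (not-involutive _)
      (derive-neg _ _ _ (cons∈signatureᵍ r∈ σ))

  derive-kind : ∀ {r} → r ∈ rules D → ∀ σ → ΓM (ruleᵍ (kindPred (kind r)) r σ)
  derive-kind r∈ σ = derive _ (inj₁ (mRule r∈)) σ [] []

  kind⇒strictOrDefeasible : ∀ {k l x B} → SD k → ΓM (kindPred k ⟦ l ∷ x ∷ B ∷ [] ⟧) →
    ΓM (strictOrDefeasible ⟦ l ∷ x ∷ B ∷ [] ⟧)
  kind⇒strictOrDefeasible {l = l} {x} {B} sdStrict d =
    derive _ (inj₁ mSD1) ⟨ vR ↦ l ∷ vH ↦ x ∷ vB ↦ B ∷ [] ⟩ (d ∷ []) []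
  kind⇒strictOrDefeasible {l = l} {x} {B} sdDefeasible d =
    derive _ (inj₁ mSD2) ⟨ vR ↦ l ∷ vH ↦ x ∷ vB ↦ B ∷ [] ⟩ (d ∷ []) []

  kind⇒rule : ∀ k {l x B} → ΓM (kindPred k ⟦ l ∷ x ∷ B ∷ [] ⟧) → ΓM (rule ⟦ l ∷ x ∷ B ∷ [] ⟧)
  kind⇒rule strictK {l} {x} {B} d =
    derive _ (inj₁ mRule1) ⟨ vR ↦ l ∷ vH ↦ x ∷ vB ↦ B ∷ [] ⟩ (kind⇒strictOrDefeasible sdStrict d ∷ []) []
  kind⇒rule defeasibleK {l} {x} {B} d =
    derive _ (inj₁ mRule1) ⟨ vR ↦ l ∷ vH ↦ x ∷ vB ↦ B ∷ [] ⟩ (kind⇒strictOrDefeasible sdDefeasible d ∷ []) []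
  kind⇒rule defeaterK {l} {x} {B} d =
    derive _ (inj₁ mRule2) ⟨ vR ↦ l ∷ vH ↦ x ∷ vB ↦ B ∷ [] ⟩ (d ∷ []) []

  derive-strictOrDefeasible : ∀ {r} → r ∈ rules D → SD (kind r) → ∀ σ →
    ΓM (ruleᵍ strictOrDefeasible r σ)
  derive-strictOrDefeasible r∈ sd σ = kind⇒strictOrDefeasible sd (derive-kind r∈ σ)

  derive-rule : ∀ {r} → r ∈ rules D → ∀ σ → ΓM (ruleᵍ rule r σ)
  derive-rule r∈ σ = kind⇒rule _ (derive-kind r∈ σ)

  derive-sup : ∀ {r s} → (r , s) ∈ supRel D → ΓM (sup ⟦ mlabᵍ r ∷ mlabᵍ s ∷ [] ⟧)
  derive-sup r>s = derive _ (inj₁ (mSup r>s)) ⟨ [] ⟩ [] []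

  derive-loop : ∀ t σ qs → All (λ q → ΓM (τ t ⟦ litM σ q ∷ [] ⟧)) qs → ΓM (loop t ⟦ listM σ qs ∷ [] ⟧)
  derive-loop t σ []       []       = derive _ (inj₁ (mLoopNil t)) σ [] []
  derive-loop t σ (q ∷ qs) (d ∷ ds) =
    derive _ (inj₁ (mLoopCons t)) ⟨ vH ↦ litM σ q ∷ vT ↦ listM σ qs ∷ [] ⟩ (d ∷ derive-loop t σ qs ds ∷ []) []

  derive-fact : ∀ {q} → q ∈ facts D → ∀ σ → ΓM (τ definitelyT ⟦ litM σ q ∷ [] ⟧)
  derive-fact {q} q∈ σ =
    derive _ (inj₁ mDef1) ⟨ vX ↦ litM σ q ∷ [] ⟩ (derive _ (inj₁ (mFact q∈)) σ [] [] ∷ []) []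

  derive-strict : ∀ {r} → r ∈ rules D → kind r ≡ strictK → ∀ σ →
    ΓM (loop definitelyT ⟦ listM σ (ante r) ∷ [] ⟧) → ΓM (τ definitelyT ⟦ litM σ (cons r) ∷ [] ⟧)
  derive-strict {r} r∈ isStrict σ ants =
    derive _ (inj₁ mDef2) ⟨ vX ↦ litM σ (cons r) ∷ vY ↦ listM σ (ante r) ∷ vR ↦ mlabᵍ (label r) ∷ [] ⟩
      (subst (λ k → ΓM (ruleᵍ (kindPred k) r σ)) isStrict (derive-kind r∈ σ) ∷ ants ∷ []) []

  definitely⇒lambda : ∀ {x} → ΓM (τ definitelyT ⟦ x ∷ [] ⟧) → ΓM (τ lambdaT ⟦ x ∷ [] ⟧)
  definitely⇒lambda {x} d = derive _ (inj₁ mLam1) ⟨ vX ↦ x ∷ [] ⟩ (d ∷ []) []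

  definitely⇒defeasibly : ∀ {x} → ΓM (τ definitelyT ⟦ x ∷ [] ⟧) → ΓM (τ defeasiblyT ⟦ x ∷ [] ⟧)
  definitely⇒defeasibly {x} d = derive _ (inj₁ mDfs1) ⟨ vX ↦ x ∷ [] ⟩ (d ∷ []) []

module DeriveS (D : Theory) (Ext : Program SPred SFun) (I : SGAtom → Set) where

  ΓS : SGAtom → Set
  ΓS = Γ (SBase D ∪ᴾ Ext) I

  atS : (Bool → ℕ → SPred) → (ℕ → SGTerm) → Lit → SGAtom
  atS X σ q = X (Lit.positive q) (Lit.pred q) ⟦ argsS σ q ⟧

  bodyᵍ : (ℕ → SPred) → Rule → (ℕ → SGTerm) → SGAtom
  bodyᵍ B r σ = B (label r) ⟦ argsS σ (cons r) ⟧

  derive-bodyΔ : ∀ {r} → r ∈ rules D → kind r ≡ strictK → ∀ σ →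
    All (ΓS ∘ atS definitely_ σ) (ante r) → ΓS (bodyᵍ bodyΔ r σ)
  derive-bodyΔ r∈ isStrict σ ds = derive _ (inj₁ (sBodyΔ r∈ isStrict)) σ (map⁺ ds) []

  derive-bodyλ : ∀ {r} → r ∈ rules D → ∀ σ → All (ΓS ∘ atS lambda_ σ) (ante r) → ΓS (bodyᵍ bodyλ r σ)
  derive-bodyλ r∈ σ ds = derive _ (inj₁ (sBodyλ r∈)) σ (map⁺ ds) []

  derive-bodyd : ∀ {r} → r ∈ rules D → ∀ σ → All (ΓS ∘ atS defeasibly_ σ) (ante r) → ΓS (bodyᵍ bodyd r σ)
  derive-bodyd r∈ σ ds = derive _ (inj₁ (sBodyd r∈)) σ (map⁺ ds) []

  sTag-cases : ∀ t → sTag t ≡ definitely_ ⊎ (sTag t ≡ lambda_ ⊎ sTag t ≡ defeasibly_)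
  sTag-cases definitelyT = inj₁ refl
  sTag-cases lambdaT     = inj₂ (inj₁ refl)
  sTag-cases defeasiblyT = inj₂ (inj₂ refl)

  derive-fact : ∀ {q} → q ∈ facts D → ∀ t σ → ΓS (atS (sTag t) σ q)
  derive-fact q∈ t σ = derive _ (inj₁ (sFact q∈ (sTag t) (sTag-cases t))) σ [] []

  derive-strict : ∀ {r} → r ∈ rules D → kind r ≡ strictK → ∀ t σ →
    ΓS (bodyᵍ bodyΔ r σ) → ΓS (atS (sTag t) σ (cons r))
  derive-strict r∈ isStrict t σ body =
    derive _ (inj₁ (sStrict r∈ isStrict (sTag t) (sTag-cases t))) σ (body ∷ []) []

LitWith : (Bool → ℕ → List MGTerm → Set) → MGTerm → Set
LitWith P x = Σ Bool λ b → Σ ℕ λ p → Σ (List MGTerm) λ as → x ≡ mlitᵍ b p as × P b p as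

complement-agrees : ∀ {x y : MGTerm} {b p as b₁ p₁ as₁ b₂ p₂ as₂} →
  x ≡ mlitᵍ b p as → y ≡ mlitᵍ (not b) p as → x ≡ mlitᵍ b₁ p₁ as₁ → y ≡ mlitᵍ b₂ p₂ as₂ →
  (b₂ ≡ not b₁) × (p₂ ≡ p₁) × (as₂ ≡ as₁)
complement-agrees refl refl refl refl = refl , refl , refl

complement-of-instance : ∀ {x y : MGTerm} {b p as} σ q →
  x ≡ mlitᵍ b p as → y ≡ mlitᵍ (not b) p as → y ≡ litM σ q → x ≡ litM σ (∼ q)
complement-of-instance {b = b} σ q refl refl refl = cong (λ c → mlitᵍ c _ _) (sym (not-involutive b))

mlabᵍ-injective : ∀ {r s} → mlabᵍ r ≡ mlabᵍ s → r ≡ s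
mlabᵍ-injective refl = refl

consSign : Rule → Bool
consSign r = Lit.positive (cons r)

consPred : Rule → ℕ
consPred r = Lit.pred (cons r)

module Forward (D : Theory) (ExtM : Program MPred MFun) (IM : MGAtom → Set)
               (ExtS : Program SPred SFun) (IS : SGAtom → Set) (MeaningExt : MGAtom → Set)
               (reflect-definitely : ∀ {b p as} → IS (definitely_ b p ⟦ toSs as ⟧) →
                                     IM (τ definitelyT ⟦ mlitᵍ b p as ∷ [] ⟧)) where
  open DeriveS D ExtS IS public

  RuleInstance : (Kind → Set) → MGTerm → MGTerm → MGTerm → Set
  RuleInstance K l x B = Σ Rule λ r → r ∈ rules D × K (kind r) × Σ (ℕ → MGTerm) λ σ →
    l ≡ mlabᵍ (label r) × x ≡ litM σ (cons r) × B ≡ listM σ (ante r)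

  -- S derives all three tags of a definite conclusion from the same clause instance,
  -- whereas the metaprogram derives lambda and defeasibly from definitely.
  TagsS : Tag → Bool → ℕ → List SGTerm → Set
  TagsS definitelyT b p as = ∀ t → ΓS (sTag t b p ⟦ as ⟧)
  TagsS lambdaT     b p as = ΓS (lambda_ b p ⟦ as ⟧)
  TagsS defeasiblyT b p as = ΓS (defeasibly_ b p ⟦ as ⟧)

  TagsS⇒ΓS : ∀ t {b p as} → TagsS t b p as → ΓS (sTag t b p ⟦ as ⟧)
  TagsS⇒ΓS definitelyT g = g definitelyT
  TagsS⇒ΓS lambdaT     g = g
  TagsS⇒ΓS defeasiblyT g = g

  CompiledIn : Tag → MGTerm → Set
  CompiledIn t = LitWith (λ b p as → TagsS t b p (toSs as))

  data AllCompiledIn (t : Tag) : MGTerm → Set where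
    []  : AllCompiledIn t (gfn mnil [])
    _∷_ : ∀ {x xs} → CompiledIn t x → AllCompiledIn t xs → AllCompiledIn t (gfn mcons (x ∷ xs ∷ []))

  MeaningInS : MGAtom → Set
  MeaningInS (fact ⟦ x ∷ [] ⟧)                           =
    Σ Lit λ q → q ∈ facts D × Σ (ℕ → MGTerm) λ σ → x ≡ litM σ q
  MeaningInS (strict ⟦ l ∷ x ∷ B ∷ [] ⟧)                 = RuleInstance (_≡ strictK) l x B
  MeaningInS (defeasible ⟦ l ∷ x ∷ B ∷ [] ⟧)             = RuleInstance (_≡ defeasibleK) l x B
  MeaningInS (defeater ⟦ l ∷ x ∷ B ∷ [] ⟧)               = RuleInstance (_≡ defeaterK) l x B
  MeaningInS (rule ⟦ l ∷ x ∷ B ∷ [] ⟧)                   = RuleInstance (λ _ → ⊤) l x B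
  MeaningInS (strictOrDefeasible ⟦ l ∷ x ∷ B ∷ [] ⟧)     = RuleInstance SD l x B
  MeaningInS (sup ⟦ l ∷ l′ ∷ [] ⟧)                       =
    Σ ℕ λ r → Σ ℕ λ s → (r , s) ∈ supRel D × l ≡ mlabᵍ r × l′ ≡ mlabᵍ s
  MeaningInS (neg ⟦ x ∷ y ∷ [] ⟧)                        = LitWith (λ b p as → y ≡ mlitᵍ (not b) p as) x
  MeaningInS (τ t ⟦ x ∷ [] ⟧)                            = CompiledIn t x
  MeaningInS (loop t ⟦ L ∷ [] ⟧)                         = AllCompiledIn t L
  MeaningInS a                                           = MeaningExt a

  compiled : ∀ t {x} σ q → x ≡ litM σ q →
    TagsS t (Lit.positive q) (Lit.pred q) (argsS (toS ∘ σ) q) → CompiledIn t x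
  compiled t σ q x≡ g = _ , _ , argsM σ q , x≡ , subst (TagsS t _ _) (argsS-toS σ q) g

  compiled⁻¹ : ∀ t σ q → CompiledIn t (litM σ q) → ΓS (atS (sTag t) (toS ∘ σ) q)
  compiled⁻¹ t σ q (_ , _ , _ , refl , g) = TagsS⇒ΓS t (subst (TagsS t _ _) (sym (argsS-toS σ q)) g)

  compiled⇒ΓS : ∀ t b p as → CompiledIn t (mlitᵍ b p as) → ΓS (sTag t b p ⟦ toSs as ⟧)
  compiled⇒ΓS t b p as (_ , _ , _ , refl , g) = TagsS⇒ΓS t g

  all-compiled : ∀ t σ qs → AllCompiledIn t (listM σ qs) → All (ΓS ∘ atS (sTag t) (toS ∘ σ)) qs
  all-compiled t σ []       []       = []
  all-compiled t σ (q ∷ qs) (c ∷ cs) = compiled⁻¹ t σ q c ∷ all-compiled t σ qs cs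

  bodyλ-compiled : ∀ {r L} → r ∈ rules D → ∀ σ → L ≡ listM σ (ante r) →
    AllCompiledIn lambdaT L → ΓS (bodyᵍ bodyλ r (toS ∘ σ))
  bodyλ-compiled {r} r∈ σ refl cs = derive-bodyλ r∈ (toS ∘ σ) (all-compiled lambdaT σ (ante r) cs)

  bodyd-compiled : ∀ {r L} → r ∈ rules D → ∀ σ → L ≡ listM σ (ante r) →
    AllCompiledIn defeasiblyT L → ΓS (bodyᵍ bodyd r (toS ∘ σ))
  bodyd-compiled {r} r∈ σ refl cs = derive-bodyd r∈ (toS ∘ σ) (all-compiled defeasiblyT σ (ante r) cs)

  ¬definitely-complement : ∀ {x y b p as} σ q → x ≡ mlitᵍ b p as → y ≡ mlitᵍ (not b) p as →
    x ≡ litM σ q → ¬ IM (τ definitelyT ⟦ y ∷ [] ⟧) → ¬ IS (atS definitely_ (toS ∘ σ) (∼ q))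
  ¬definitely-complement σ q refl refl refl ¬y i =
    ¬y (reflect-definitely (subst (λ as → IS (definitely_ _ _ ⟦ as ⟧)) (argsS-toS σ q) i))

  kind-instance : ∀ {r} → r ∈ rules D → ∀ σ k → kind r ≡ k → MeaningInS (ruleᵍ (kindPred k) r σ)
  kind-instance r∈ σ strictK     e = _ , r∈ , e , σ , refl , refl , refl
  kind-instance r∈ σ defeasibleK e = _ , r∈ , e , σ , refl , refl , refl
  kind-instance r∈ σ defeaterK   e = _ , r∈ , e , σ , refl , refl , refl

  MBase-preserves : Preserves (MBase D) IM MeaningInS
  MBase-preserves (mFact q∈)       σ [] [] = _ , q∈ , σ , refl
  MBase-preserves (mRule r∈)       σ [] [] = kind-instance r∈ σ _ refl
  MBase-preserves (mSup r>s)       σ [] [] = _ , _ , r>s , refl , refl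
  MBase-preserves (mNeg b _)       σ [] [] = b , _ , _ , refl , refl
  MBase-preserves mRule1 σ ((r , r∈ , _ , inst) ∷ []) [] = r , r∈ , tt , inst
  MBase-preserves mRule2 σ ((r , r∈ , _ , inst) ∷ []) [] = r , r∈ , tt , inst
  MBase-preserves mSD1 σ ((r , r∈ , k , inst) ∷ []) [] = r , r∈ , subst SD (sym k) sdStrict , inst
  MBase-preserves mSD2 σ ((r , r∈ , k , inst) ∷ []) [] = r , r∈ , subst SD (sym k) sdDefeasible , inst
  MBase-preserves (mLoopNil t)  σ [] [] = []
  MBase-preserves (mLoopCons t) σ (c ∷ cs ∷ []) [] = c ∷ cs
  MBase-preserves mDef1 σ ((q , q∈ , σ′ , x≡) ∷ []) [] =
    compiled definitelyT σ′ q x≡ (λ t → derive-fact q∈ t (toS ∘ σ′))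
  MBase-preserves mDef2 σ ((r , r∈ , isStrict , σ′ , _ , x≡ , L≡) ∷ ants ∷ []) [] =
    compiled definitelyT σ′ (cons r) x≡ λ t → derive-strict r∈ isStrict t (toS ∘ σ′)
      (derive-bodyΔ r∈ isStrict (toS ∘ σ′)
        (all-compiled definitelyT σ′ (ante r) (subst (AllCompiledIn definitelyT) L≡ ants)))
  MBase-preserves mLam1 σ ((b , p , as , x≡ , g) ∷ []) [] = b , p , as , x≡ , g lambdaT
  MBase-preserves mLam2 σ ((_ , _ , _ , x≡ , x′≡) ∷ (r , r∈ , sd , σ′ , _ , x≡r , L≡) ∷ ants ∷ [])
                  (¬def ∷ []) =
    compiled lambdaT σ′ (cons r) x≡r
      (derive _ (inj₁ (sLam r∈ sd)) (toS ∘ σ′)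
        (bodyλ-compiled r∈ σ′ L≡ ants ∷ [])
        (¬definitely-complement σ′ (cons r) x≡ x′≡ x≡r ¬def ∷ []))
  MBase-preserves mDfs1 σ ((b , p , as , x≡ , g) ∷ []) [] = b , p , as , x≡ , g defeasiblyT

module Backward (D : Theory) (labelsUnique : Unique (map label (rules D)))
                (ExtM : Program MPred MFun) (IM : MGAtom → Set)
                (ExtS : Program SPred SFun) (IS : SGAtom → Set) (MeaningExt : SGAtom → Set)
                (reflect-definitely : ∀ {b p as} → IM (τ definitelyT ⟦ mlitᵍ b p as ∷ [] ⟧) →
                                      IS (definitely_ b p ⟦ toSs as ⟧)) where
  open DeriveM D ExtM IM public

  HoldsM : Tag → Bool → ℕ → List SGTerm → Set
  HoldsM t b p args = ΓM (τ t ⟦ mlitᵍ b p (toMs args) ∷ [] ⟧)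

  BodyInstance : Tag → ℕ → List SGTerm → Set
  BodyInstance t l args = Σ Rule λ r → r ∈ rules D × l ≡ label r × Σ (ℕ → SGTerm) λ σ →
    args ≡ argsS σ (cons r) × ΓM (loop t ⟦ listM (toM ∘ σ) (ante r) ∷ [] ⟧)

  MeaningInM : SGAtom → Set
  MeaningInM (definitely_ b p ⟦ args ⟧) = HoldsM definitelyT b p args
  MeaningInM (lambda_ b p ⟦ args ⟧)     = HoldsM lambdaT b p args
  MeaningInM (defeasibly_ b p ⟦ args ⟧) = HoldsM defeasiblyT b p args
  MeaningInM (bodyΔ l ⟦ args ⟧)         = BodyInstance definitelyT l args
  MeaningInM (bodyλ l ⟦ args ⟧)         = BodyInstance lambdaT l args
  MeaningInM (bodyd l ⟦ args ⟧)         = BodyInstance defeasiblyT l args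
  MeaningInM a                          = MeaningExt a

  argsM-toMs : ∀ {args} σ q → args ≡ argsS σ q → argsM (toM ∘ σ) q ≡ toMs args
  argsM-toMs σ q args≡ = trans (argsM-toM σ q) (cong toMs (sym args≡))

  toSs-argsM : ∀ {args} σ q → args ≡ argsS σ q → toSs (argsM (toM ∘ σ) q) ≡ args
  toSs-argsM σ q args≡ = trans (cong toSs (argsM-toMs σ q args≡)) (toSs∘toMs _)

  at-toMs : ∀ (A : MGTerm → MGAtom) {args} σ q → args ≡ argsS σ q →
    ΓM (A (litM (toM ∘ σ) q)) → ΓM (A (mlitᵍ (Lit.positive q) (Lit.pred q) (toMs args)))
  at-toMs A σ q args≡ = subst (λ as → ΓM (A (mlitᵍ _ _ as))) (argsM-toMs σ q args≡)

  holds : ∀ t {args} σ q → args ≡ argsS σ q →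
    ΓM (τ t ⟦ litM (toM ∘ σ) q ∷ [] ⟧) → HoldsM t (Lit.positive q) (Lit.pred q) args
  holds t = at-toMs (λ x → τ t ⟦ x ∷ [] ⟧)

  holds⁻¹ : ∀ t σ q → HoldsM t (Lit.positive q) (Lit.pred q) (argsS σ q) →
    ΓM (τ t ⟦ litM (toM ∘ σ) q ∷ [] ⟧)
  holds⁻¹ t σ q = subst (λ as → ΓM (τ t ⟦ mlitᵍ _ _ as ∷ [] ⟧)) (sym (argsM-toM σ q))

  meaning⇒holds : ∀ t b p as → MeaningInM (sTag t b p ⟦ toSs as ⟧) → ΓM (τ t ⟦ mlitᵍ b p as ∷ [] ⟧)
  meaning⇒holds definitelyT b p as = subst (λ as → ΓM (τ definitelyT ⟦ mlitᵍ b p as ∷ [] ⟧)) (toMs∘toSs as)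
  meaning⇒holds lambdaT     b p as = subst (λ as → ΓM (τ lambdaT ⟦ mlitᵍ b p as ∷ [] ⟧)) (toMs∘toSs as)
  meaning⇒holds defeasiblyT b p as = subst (λ as → ΓM (τ defeasiblyT ⟦ mlitᵍ b p as ∷ [] ⟧)) (toMs∘toSs as)

  derive-ante : ∀ t σ qs → All (λ q → HoldsM t (Lit.positive q) (Lit.pred q) (argsS σ q)) qs →
    ΓM (loop t ⟦ listM (toM ∘ σ) qs ∷ [] ⟧)
  derive-ante t σ qs hs = derive-loop t (toM ∘ σ) qs (All.map (holds⁻¹ t σ _) hs)

  same-rule : ∀ {r r′} → r ∈ rules D → r′ ∈ rules D → label r ≡ label r′ → r′ ≡ r
  same-rule r∈ r′∈ e = map-injectiveᵘ labelsUnique r′∈ r∈ (sym e)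

  definitely⇒meaning : ∀ {X} → X ≡ definitely_ ⊎ (X ≡ lambda_ ⊎ X ≡ defeasibly_) → ∀ {args} σ q →
    args ≡ argsS σ q → ΓM (τ definitelyT ⟦ litM (toM ∘ σ) q ∷ [] ⟧) →
    MeaningInM (X (Lit.positive q) (Lit.pred q) ⟦ args ⟧)
  definitely⇒meaning (inj₁ refl)        σ q args≡ d = holds definitelyT σ q args≡ d
  definitely⇒meaning (inj₂ (inj₁ refl)) σ q args≡ d = holds lambdaT σ q args≡ (definitely⇒lambda d)
  definitely⇒meaning (inj₂ (inj₂ refl)) σ q args≡ d = holds defeasiblyT σ q args≡ (definitely⇒defeasibly d)

  ¬definitely-complement : ∀ {args} σ q → args ≡ argsS σ q →
    ¬ IS (definitely_ (not (Lit.positive q)) (Lit.pred q) ⟦ args ⟧) →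
    ¬ IM (τ definitelyT ⟦ litM (toM ∘ σ) (∼ q) ∷ [] ⟧)
  ¬definitely-complement σ q args≡ ¬def i =
    ¬def (subst (λ as → IS (definitely_ _ _ ⟦ as ⟧)) (toSs-argsM σ q args≡) (reflect-definitely i))

  viaRule : Rule → (ℕ → SGTerm) → List (MTerm × MGTerm)
  viaRule r σ = vX ↦ litM (toM ∘ σ) (cons r) ∷ vY ↦ listM (toM ∘ σ) (ante r)
    ∷ vR ↦ mlabᵍ (label r) ∷ vX' ↦ litM (toM ∘ σ) (∼ cons r) ∷ []

  SBase-preserves : Preserves (SBase D) IS MeaningInM
  SBase-preserves (sFact {q} q∈ _ X∈) σ [] [] = definitely⇒meaning X∈ σ q refl (derive-fact q∈ (toM ∘ σ))
  SBase-preserves (sStrict {r} r∈ isStrict _ X∈) σ ((_ , r′∈ , l≡ , σ′ , args≡ , ants) ∷ []) []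
    with same-rule r∈ r′∈ l≡
  ... | refl = definitely⇒meaning X∈ σ′ (cons r) args≡ (derive-strict r∈ isStrict (toM ∘ σ′) ants)
  SBase-preserves (sBodyΔ {r} r∈ _) σ hs [] =
    r , r∈ , refl , σ , refl , derive-ante definitelyT σ (ante r) (map⁻ hs)
  SBase-preserves (sBodyλ {r} r∈) σ hs [] =
    r , r∈ , refl , σ , refl , derive-ante lambdaT σ (ante r) (map⁻ hs)
  SBase-preserves (sBodyd {r} r∈) σ hs [] =
    r , r∈ , refl , σ , refl , derive-ante defeasiblyT σ (ante r) (map⁻ hs)
  SBase-preserves (sLam {r} r∈ sd) σ ((_ , r′∈ , l≡ , σ′ , args≡ , ants) ∷ []) (¬def ∷ [])
    with same-rule r∈ r′∈ l≡
  ... | refl = holds lambdaT σ′ (cons r) args≡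
        (derive _ (inj₁ mLam2) ⟨ viaRule r σ′ ⟩
          (derive-neg-cons r∈ (toM ∘ σ′) ∷ derive-strictOrDefeasible r∈ sd (toM ∘ σ′) ∷ ants ∷ [])
          (¬definitely-complement σ′ (cons r) args≡ ¬def ∷ []))

data Corr∂ (D : Theory) : MGAtom → SGAtom → Set where
  τ∼         : ∀ t b p as → Corr∂ D (τ t ⟦ mlitᵍ b p as ∷ [] ⟧) (sTag t b p ⟦ toSs as ⟧)
  overruled∼ : ∀ b p as → Corr∂ D (overruled ⟦ mlitᵍ b p as ∷ [] ⟧) (overruled_ b p ⟦ toSs as ⟧)
  defeated∼  : ∀ {s} → s ∈ rules D → ∀ as →
    Corr∂ D (defeated ⟦ mlabᵍ (label s) ∷ mlitᵍ (consSign s) (consPred s) as ∷ [] ⟧)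
            (defeated_ (consSign s) (consPred s) ⟦ slabᵍ (label s) ∷ toSs as ⟧)

module Forward∂ (D : Theory) (IM : MGAtom → Set) (IS : SGAtom → Set)
                (reflect : ∀ {a s} → Corr∂ D a s → IS s → IM a) where

  MeaningExt : MGAtom → Set
  MeaningExt (overruled ⟦ x ∷ [] ⟧) = LitWith (λ b p as → Γ (S D) IS (overruled_ b p ⟦ toSs as ⟧)) x
  MeaningExt (defeated ⟦ l ∷ x ∷ [] ⟧) = ∀ {s} → s ∈ rules D → l ≡ mlabᵍ (label s) →
    ∀ as → x ≡ mlitᵍ (consSign s) (consPred s) as →
    Γ (S D) IS (defeated_ (consSign s) (consPred s) ⟦ slabᵍ (label s) ∷ toSs as ⟧)
  MeaningExt _ = ⊤

  open Forward D (MPar D) IM (SPar D) IS MeaningExt (reflect (τ∼ definitelyT _ _ _))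

  ¬overruled : ∀ {x} σ q → x ≡ litM σ q → ¬ IM (overruled ⟦ x ∷ [] ⟧) → ¬ IS (atS overruled_ (toS ∘ σ) q)
  ¬overruled σ q refl ¬ov i =
    ¬ov (reflect (overruled∼ _ _ _) (subst (λ as → IS (overruled_ _ _ ⟦ as ⟧)) (argsS-toS σ q) i))

  ¬defeated : ∀ {s l x} → s ∈ rules D → ∀ σ → l ≡ mlabᵍ (label s) → x ≡ litM σ (cons s) →
    ¬ IM (defeated ⟦ l ∷ x ∷ [] ⟧) →
    ¬ IS (defeated_ (consSign s) (consPred s) ⟦ slabᵍ (label s) ∷ argsS (toS ∘ σ) (cons s) ⟧)
  ¬defeated {s} s∈ σ refl refl ¬defd i =
    ¬defd (reflect (defeated∼ s∈ _) (subst (λ as → IS (defeated_ _ _ ⟦ _ ∷ as ⟧)) (argsS-toS σ (cons s)) i))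

  defeated-cong : ∀ {b b′ p p′ l} {as as′ : List SGTerm} → b ≡ b′ → p ≡ p′ → as ≡ as′ →
    ΓS (defeated_ b p ⟦ l ∷ as ⟧) → ΓS (defeated_ b′ p′ ⟦ l ∷ as′ ⟧)
  defeated-cong refl refl refl d = d

  MPar-preserves : Preserves (MPar D) IM MeaningInS
  MPar-preserves mDfs2 σ ((_ , _ , _ , x≡ , x′≡) ∷ (r , r∈ , sd , σ′ , _ , x≡r , L≡) ∷ ants ∷ [])
                 (¬def ∷ ¬ov ∷ []) =
    compiled defeasiblyT σ′ (cons r) x≡r
      (derive _ (inj₂ (sDfs r∈ sd)) (toS ∘ σ′)
        (bodyd-compiled r∈ σ′ L≡ ants ∷ [])
        (¬definitely-complement σ′ (cons r) x≡ x′≡ x≡r ¬def ∷ ¬overruled σ′ (cons r) x≡r ¬ov ∷ []))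
  MPar-preserves mOver σ ((_ , _ , _ , x≡ , x′≡) ∷ (s , s∈ , _ , σ′ , l≡ , x′≡s , L≡) ∷ ants ∷ [])
                 (¬defd ∷ []) =
    _ , _ , argsM σ′ (cons s) , complement-of-instance σ′ (cons s) x≡ x′≡ x′≡s ,
    subst (λ as → ΓS (overruled_ _ _ ⟦ as ⟧)) (argsS-toS σ′ (cons s))
      (derive _ (inj₂ (sOver s∈)) (toS ∘ σ′)
        (bodyλ-compiled s∈ σ′ L≡ ants ∷ [])
        (¬defeated s∈ σ′ l≡ x′≡s ¬defd ∷ []))
  MPar-preserves mDefd σ ((_ , _ , _ , x≡ , x′≡) ∷ (_ , _ , t>s , lt≡ , ls≡)
                          ∷ (t , t∈ , sd , σ′ , lt≡t , x≡t , L≡) ∷ ants ∷ [])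
                 [] s∈ ls≡s as x′≡s =
    let sign≡ , pred≡ , as≡ = complement-agrees x≡ x′≡ x≡t x′≡s
        t>s′ = subst₂ (λ u v → (u , v) ∈ supRel D)
                 (mlabᵍ-injective (trans (sym lt≡) lt≡t)) (mlabᵍ-injective (trans (sym ls≡) ls≡s)) t>s
    in defeated-cong (sym sign≡) (sym pred≡) (trans (argsS-toS σ′ (cons t)) (cong toSs (sym as≡)))
         (derive _ (inj₂ (sDefd t∈ sd s∈ (sign≡ , pred≡) t>s′)) (toS ∘ σ′)
           (bodyd-compiled t∈ σ′ L≡ ants ∷ []) [])

  meaningInS : ∀ {a} → Γ (M∂ D) IM a → MeaningInS a
  meaningInS = Γ-induction
    (Preserves-∪ {Π₁ = MBase D} {Π₂ = MPar D} {I = IM} {G = MeaningInS}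
      MBase-preserves MPar-preserves)

  meaning⇒ΓS : ∀ {a s} → Corr∂ D a s → MeaningInS a → Γ (S D) IS s
  meaning⇒ΓS (τ∼ t b p as)       m                       = compiled⇒ΓS t b p as m
  meaning⇒ΓS (overruled∼ b p as) (_ , _ , _ , refl , d) = d
  meaning⇒ΓS (defeated∼ s∈ as)   m                       = m s∈ refl as refl

  simulate : ∀ {a s} → Corr∂ D a s → Γ (M∂ D) IM a → Γ (S D) IS s
  simulate c = meaning⇒ΓS c ∘ meaningInS

module Backward∂ (D : Theory) (labelsUnique : Unique (map label (rules D)))
                 (IM : MGAtom → Set) (IS : SGAtom → Set)
                 (reflect : ∀ {a s} → Corr∂ D a s → IM a → IS s) where

  MeaningExt : SGAtom → Set
  MeaningExt (overruled_ b p ⟦ args ⟧) = Γ (M∂ D) IM (overruled ⟦ mlitᵍ b p (toMs args) ∷ [] ⟧)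
  MeaningExt (defeated_ b p ⟦ l ∷ args ⟧) =
    Σ ℕ λ s → l ≡ slabᵍ s × Γ (M∂ D) IM (defeated ⟦ mlabᵍ s ∷ mlitᵍ b p (toMs args) ∷ [] ⟧)
  MeaningExt _ = ⊤

  open Backward D labelsUnique (MPar D) IM (SPar D) IS MeaningExt (reflect (τ∼ definitelyT _ _ _))

  SPar-preserves : Preserves (SPar D) IS MeaningInM
  SPar-preserves (sDfs {r} r∈ sd) σ ((_ , r′∈ , l≡ , σ′ , args≡ , ants) ∷ []) (¬def ∷ ¬ov ∷ [])
    with same-rule r∈ r′∈ l≡
  ... | refl = holds defeasiblyT σ′ (cons r) args≡
        (derive _ (inj₂ mDfs2) ⟨ viaRule r σ′ ⟩
          (derive-neg-cons r∈ (toM ∘ σ′) ∷ derive-strictOrDefeasible r∈ sd (toM ∘ σ′) ∷ ants ∷ [])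
          (¬definitely-complement σ′ (cons r) args≡ ¬def
           ∷ (λ i → ¬ov (subst (λ as → IS (overruled_ _ _ ⟦ as ⟧)) (toSs-argsM σ′ (cons r) args≡)
                            (reflect (overruled∼ _ _ _) i)))
           ∷ []))
  SPar-preserves (sOver {s} s∈) σ ((_ , s′∈ , l≡ , σ′ , args≡ , ants) ∷ []) (¬defd ∷ [])
    with same-rule s∈ s′∈ l≡
  ... | refl = at-toMs (λ x → overruled ⟦ x ∷ [] ⟧) σ′ (∼ cons s) args≡
        (derive _ (inj₂ mOver)
          ⟨ vX ↦ litM (toM ∘ σ′) (∼ cons s) ∷ vX' ↦ litM (toM ∘ σ′) (cons s)
            ∷ vS ↦ mlabᵍ (label s) ∷ vU ↦ listM (toM ∘ σ′) (ante s) ∷ [] ⟩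
          (derive-neg-∼cons s∈ (toM ∘ σ′) ∷ derive-rule s∈ (toM ∘ σ′) ∷ ants ∷ [])
          ((λ i → ¬defd (subst (λ as → IS (defeated_ _ _ ⟦ _ ∷ as ⟧)) (toSs-argsM σ′ (cons s) args≡)
                           (reflect (defeated∼ s∈ _) i)))
           ∷ []))
  SPar-preserves (sDefd {t} {s} t∈ sd s∈ _ t>s) σ ((_ , t′∈ , l≡ , σ′ , args≡ , ants) ∷ []) []
    with same-rule t∈ t′∈ l≡
  ... | refl = label s , refl ,
        at-toMs (λ x → defeated ⟦ mlabᵍ (label s) ∷ x ∷ [] ⟧) σ′ (∼ cons t) args≡
          (derive _ (inj₂ mDefd)
            ⟨ vX ↦ litM (toM ∘ σ′) (cons t) ∷ vX' ↦ litM (toM ∘ σ′) (∼ cons t)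
              ∷ vS ↦ mlabᵍ (label s) ∷ vT ↦ mlabᵍ (label t) ∷ vV ↦ listM (toM ∘ σ′) (ante t) ∷ [] ⟩
            (derive-neg-cons t∈ (toM ∘ σ′) ∷ derive-sup t>s
             ∷ derive-strictOrDefeasible t∈ sd (toM ∘ σ′) ∷ ants ∷ [])
            [])

  meaningInM : ∀ {a} → Γ (S D) IS a → MeaningInM a
  meaningInM = Γ-induction
    (Preserves-∪ {Π₁ = SBase D} {Π₂ = SPar D} {I = IS} {G = MeaningInM}
      SBase-preserves SPar-preserves)

  meaning⇒ΓM : ∀ {a s} → Corr∂ D a s → MeaningInM s → Γ (M∂ D) IM a
  meaning⇒ΓM (τ∼ t b p as)       m = meaning⇒holds t b p as m
  meaning⇒ΓM (overruled∼ b p as) d = subst (λ as → ΓM (overruled ⟦ mlitᵍ b p as ∷ [] ⟧)) (toMs∘toSs as) d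
  meaning⇒ΓM (defeated∼ s∈ as)   (_ , refl , d) =
    subst (λ as → ΓM (defeated ⟦ _ ∷ mlitᵍ _ _ as ∷ [] ⟧)) (toMs∘toSs as) d

  simulate : ∀ {a s} → Corr∂ D a s → Γ (S D) IS s → Γ (M∂ D) IM a
  simulate c = meaning⇒ΓM c ∘ meaningInM

data Corr* (D : Theory) : MGAtom → SGAtom → Set where
  τ∼         : ∀ t b p as → Corr* D (τ t ⟦ mlitᵍ b p as ∷ [] ⟧) (sTag t b p ⟦ toSs as ⟧)
  overruled∼ : ∀ {r} → r ∈ rules D → SD (kind r) → ∀ as →
    Corr* D (overruled ⟦ mlabᵍ (label r) ∷ mlitᵍ (consSign r) (consPred r) as ∷ [] ⟧)
            (overruled_ (consSign r) (consPred r) ⟦ slabᵍ (label r) ∷ toSs as ⟧)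
  defeats∼   : ∀ {r} → r ∈ rules D → ∀ s →
    Corr* D (defeats ⟦ mlabᵍ (label r) ∷ mlabᵍ s ∷ [] ⟧)
            (defeats_ (consSign r) (consPred r) ⟦ slabᵍ (label r) ∷ slabᵍ s ∷ [] ⟧)

module Forward* (D : Theory) (IM : MGAtom → Set) (IS : SGAtom → Set)
                (reflect : ∀ {a s} → Corr* D a s → IS s → IM a) where

  MeaningExt : MGAtom → Set
  MeaningExt (overruled ⟦ l ∷ x ∷ [] ⟧) = ∀ {r} → r ∈ rules D → SD (kind r) → l ≡ mlabᵍ (label r) →
    ∀ as → x ≡ mlitᵍ (consSign r) (consPred r) as →
    Γ (S* D) IS (overruled_ (consSign r) (consPred r) ⟦ slabᵍ (label r) ∷ toSs as ⟧)
  MeaningExt (defeats ⟦ l ∷ l′ ∷ [] ⟧) = Σ ℕ λ r → Σ ℕ λ s → (r , s) ∈ supRel D × l ≡ mlabᵍ r × l′ ≡ mlabᵍ s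
  MeaningExt _ = ⊤

  open Forward D (MStar D) IM (SStar D) IS MeaningExt (reflect (τ∼ definitelyT _ _ _))

  overruled-cong : ∀ {b b′ p p′ l} {as as′ : List SGTerm} → b ≡ b′ → p ≡ p′ → as ≡ as′ →
    ΓS (overruled_ b p ⟦ l ∷ as ⟧) → ΓS (overruled_ b′ p′ ⟦ l ∷ as′ ⟧)
  overruled-cong refl refl refl d = d

  MStar-preserves : Preserves (MStar D) IM MeaningInS
  MStar-preserves mDfs2* σ ((_ , _ , _ , x≡ , x′≡) ∷ (r , r∈ , sd , σ′ , l≡ , x≡r , L≡) ∷ ants ∷ [])
                  (¬def ∷ ¬ov ∷ []) =
    compiled defeasiblyT σ′ (cons r) x≡r
      (derive _ (inj₂ (sDfs* r∈ sd)) (toS ∘ σ′)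
        (bodyd-compiled r∈ σ′ L≡ ants ∷ [])
        (¬definitely-complement σ′ (cons r) x≡ x′≡ x≡r ¬def
         ∷ (λ i → ¬ov (subst₂ (λ l x → IM (overruled ⟦ l ∷ x ∷ [] ⟧)) (sym l≡) (sym x≡r)
                         (reflect (overruled∼ r∈ sd _)
                           (subst (λ as → IS (overruled_ _ _ ⟦ _ ∷ as ⟧)) (argsS-toS σ′ (cons r)) i))))
         ∷ []))
  MStar-preserves mOver* σ ((_ , _ , _ , x≡ , x′≡) ∷ (s , s∈ , _ , σ′ , ls≡ , x′≡s , L≡) ∷ ants ∷ [])
                  (¬defs ∷ [])
                  r∈ sd lr≡ as x≡r =
    let sign≡ , pred≡ , as≡ = complement-agrees x≡ x′≡ x≡r x′≡s
    in overruled-cong refl refl (trans (argsS-toS σ′ (cons s)) (cong toSs as≡))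
         (derive _ (inj₂ (sOver* r∈ sd s∈ (sign≡ , pred≡))) (toS ∘ σ′)
           (bodyλ-compiled s∈ σ′ L≡ ants ∷ [])
           ((λ i → ¬defs (subst₂ (λ l l′ → IM (defeats ⟦ l ∷ l′ ∷ [] ⟧)) (sym lr≡) (sym ls≡)
                            (reflect (defeats∼ r∈ _) i)))
            ∷ []))
  MStar-preserves mDefs* σ (m ∷ []) [] = m

  meaningInS : ∀ {a} → Γ (M∂* D) IM a → MeaningInS a
  meaningInS = Γ-induction
    (Preserves-∪ {Π₁ = MBase D} {Π₂ = MStar D} {I = IM} {G = MeaningInS}
      MBase-preserves MStar-preserves)

  meaning⇒ΓS : ∀ {a s} → Corr* D a s → MeaningInS a → Γ (S* D) IS s
  meaning⇒ΓS (τ∼ t b p as)         m                            = compiled⇒ΓS t b p as m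
  meaning⇒ΓS (overruled∼ r∈ sd as) m                            = m r∈ sd refl as refl
  meaning⇒ΓS (defeats∼ r∈ s)       (_ , _ , r>s , refl , refl) =
    derive _ (inj₂ (sDefs* r∈ r>s)) (λ _ → slabᵍ 0) [] []

  simulate : ∀ {a s} → Corr* D a s → Γ (M∂* D) IM a → Γ (S* D) IS s
  simulate c = meaning⇒ΓS c ∘ meaningInS

module Backward* (D : Theory) (labelsUnique : Unique (map label (rules D)))
                 (IM : MGAtom → Set) (IS : SGAtom → Set)
                 (reflect : ∀ {a s} → Corr* D a s → IM a → IS s) where

  MeaningExt : SGAtom → Set
  MeaningExt (overruled_ b p ⟦ l ∷ args ⟧) =
    Σ ℕ λ r → l ≡ slabᵍ r × Γ (M∂* D) IM (overruled ⟦ mlabᵍ r ∷ mlitᵍ b p (toMs args) ∷ [] ⟧)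
  MeaningExt (defeats_ b p ⟦ l ∷ l′ ∷ [] ⟧) =
    Σ ℕ λ r → Σ ℕ λ s → l ≡ slabᵍ r × l′ ≡ slabᵍ s × Γ (M∂* D) IM (defeats ⟦ mlabᵍ r ∷ mlabᵍ s ∷ [] ⟧)
  MeaningExt _ = ⊤

  open Backward D labelsUnique (MStar D) IM (SStar D) IS MeaningExt (reflect (τ∼ definitelyT _ _ _))

  SStar-preserves : Preserves (SStar D) IS MeaningInM
  SStar-preserves (sDfs* {r} r∈ sd) σ ((_ , r′∈ , l≡ , σ′ , args≡ , ants) ∷ []) (¬def ∷ ¬ov ∷ [])
    with same-rule r∈ r′∈ l≡
  ... | refl = holds defeasiblyT σ′ (cons r) args≡
        (derive _ (inj₂ mDfs2*) ⟨ viaRule r σ′ ⟩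
          (derive-neg-cons r∈ (toM ∘ σ′) ∷ derive-strictOrDefeasible r∈ sd (toM ∘ σ′) ∷ ants ∷ [])
          (¬definitely-complement σ′ (cons r) args≡ ¬def
           ∷ (λ i → ¬ov (subst (λ as → IS (overruled_ _ _ ⟦ _ ∷ as ⟧)) (toSs-argsM σ′ (cons r) args≡)
                            (reflect (overruled∼ r∈ sd _) i)))
           ∷ []))
  SStar-preserves (sOver* {r} {s} r∈ sd s∈ (sign≡ , pred≡)) σ ((_ , s′∈ , l≡ , σ′ , args≡ , ants) ∷ [])
                  (¬defs ∷ [])
    with same-rule s∈ s′∈ l≡
  ... | refl = label r , refl ,
        subst (λ as → ΓM (overruled ⟦ mlabᵍ (label r) ∷ mlitᵍ _ _ as ∷ [] ⟧)) (argsM-toMs σ′ (cons s) args≡)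
          (derive _ (inj₂ mOver*)
            ⟨ vR ↦ mlabᵍ (label r) ∷ vX ↦ mlitᵍ (consSign r) (consPred r) (argsM (toM ∘ σ′) (cons s))
              ∷ vX' ↦ litM (toM ∘ σ′) (cons s) ∷ vS ↦ mlabᵍ (label s)
              ∷ vU ↦ listM (toM ∘ σ′) (ante s) ∷ [] ⟩
            (subst₂ (λ b p → ΓM (neg ⟦ mlitᵍ b p _ ∷ litM (toM ∘ σ′) (cons s) ∷ [] ⟧))
               (trans (cong not sign≡) (not-involutive _)) pred≡ (derive-neg-∼cons s∈ (toM ∘ σ′))
             ∷ derive-rule s∈ (toM ∘ σ′) ∷ ants ∷ [])
            ((λ i → ¬defs (reflect (defeats∼ r∈ _) i)) ∷ []))
  SStar-preserves (sDefs* {r} {s} r∈ r>s) σ [] [] =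
    label r , s , refl , refl ,
    derive _ (inj₂ mDefs*) ⟨ vR ↦ mlabᵍ (label r) ∷ vS ↦ mlabᵍ s ∷ [] ⟩ (derive-sup r>s ∷ []) []

  meaningInM : ∀ {a} → Γ (S* D) IS a → MeaningInM a
  meaningInM = Γ-induction
    (Preserves-∪ {Π₁ = SBase D} {Π₂ = SStar D} {I = IS} {G = MeaningInM}
      SBase-preserves SStar-preserves)

  meaning⇒ΓM : ∀ {a s} → Corr* D a s → MeaningInM s → Γ (M∂* D) IM a
  meaning⇒ΓM (τ∼ t b p as)         m                     = meaning⇒holds t b p as m
  meaning⇒ΓM (overruled∼ r∈ sd as) (_ , refl , d)        =
    subst (λ as → ΓM (overruled ⟦ _ ∷ mlitᵍ _ _ as ∷ [] ⟧)) (toMs∘toSs as) d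
  meaning⇒ΓM (defeats∼ r∈ s)       (_ , _ , refl , refl , d) = d

  simulate : ∀ {a s} → Corr* D a s → Γ (S* D) IS s → Γ (M∂* D) IM a
  simulate c = meaning⇒ΓM c ∘ meaningInM

M∂⇔S : ∀ D → WellFormed D → ∀ {a s} → Corr∂ D a s → (M∂ D ⊨WF a) ⇔ (S D ⊨WF s)
M∂⇔S D wf = ⊨WF-transfer (λ reflect → Forward∂.simulate D _ _ reflect)
                         (λ reflect → Backward∂.simulate D (WellFormed.labelsUnique wf) _ _ reflect)

M∂*⇔S* : ∀ D → WellFormed D → ∀ {a s} → Corr* D a s → (M∂* D ⊨WF a) ⇔ (S* D ⊨WF s)
M∂*⇔S* D wf = ⊨WF-transfer (λ reflect → Forward*.simulate D _ _ reflect)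
                           (λ reflect → Backward*.simulate D (WellFormed.labelsUnique wf) _ _ reflect)

theorem2 : (D : Theory) → WellFormed D →
    (b : Bool) (p : ℕ) (as : List (GTerm ℕ)) →
    ((M∂ D ⊨WF mQuery definitelyT b p as) ⇔ (S D ⊨WF sQuery definitely_ b p as))
    × ((M∂ D ⊨WF mQuery lambdaT b p as) ⇔ (S D ⊨WF sQuery lambda_ b p as))
    × ((M∂ D ⊨WF mQuery defeasiblyT b p as) ⇔ (S D ⊨WF sQuery defeasibly_ b p as))
    × ((M∂* D ⊨WF mQuery definitelyT b p as) ⇔ (S* D ⊨WF sQuery definitely_ b p as))
    × ((M∂* D ⊨WF mQuery lambdaT b p as) ⇔ (S* D ⊨WF sQuery lambda_ b p as))
    × ((M∂* D ⊨WF mQuery defeasiblyT b p as) ⇔ (S* D ⊨WF sQuery defeasibly_ b p as))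
theorem2 D wf b p as =
  query∂ definitelyT , query∂ lambdaT , query∂ defeasiblyT ,
  query* definitelyT , query* lambdaT , query* defeasiblyT
  where
  query∂ : ∀ t → (M∂ D ⊨WF mQuery t b p as) ⇔ (S D ⊨WF (sTag t b p ⟦ gmaps sfun as ⟧))
  query∂ t = subst (λ args → (M∂ D ⊨WF mQuery t b p as) ⇔ (S D ⊨WF (sTag t b p ⟦ args ⟧))) (toSs-dfun as)
               (M∂⇔S D wf (τ∼ t b p (gmaps dfun as)))

  query* : ∀ t → (M∂* D ⊨WF mQuery t b p as) ⇔ (S* D ⊨WF (sTag t b p ⟦ gmaps sfun as ⟧))
  query* t = subst (λ args → (M∂* D ⊨WF mQuery t b p as) ⇔ (S* D ⊨WF (sTag t b p ⟦ args ⟧))) (toSs-dfun as)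
               (M∂*⇔S* D wf (τ∼ t b p (gmaps dfun as)))
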